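{- Let $(X,\le,c)$ be a finite strongly involution poset, let $A\in\mathcal{W}_+(X,\mathbf{2})$ (resp. $A\in\mathcal{W}_-(X,\mathbf{2})$), and set $N(A)=\mathrm{Min}(A^{ -1}(P))\cup\mathrm{Max}(A^{ -1}(N))$. Then $N(A)$ is a $\mathcal{W}_+(X,\mathbf{2})$-core (resp. $\mathcal{W}_-(X,\mathbf{2})$-core) for $A$.
   Context: A strongly involution poset is a poset $(X,\le)$ with $c:X\to X$, $x\mapsto x^c$, such that $(x^c)^c=x$, $x\le y\Rightarrow y^c\le x^c$, and $x^c\ne x$ for all $x$ (when $|X|\ge2$). For $Z\subseteq X$: $Z^c=\{z^c:z\in Z\}$, $\mathrm{Min}(Z),\mathrm{Max}(Z)$ the minimal/maximal elements of $Z$. $\mathbf{2}$ is the chain $N<P$. $\mathcal{W}_+(X,\mathbf{2})$ (resp. $\mathcal{W}_-(X,\mathbf{2})$) is the set of maps $A:X\to\mathbf{2}$ such that $A^{ -1}(P)$ is an up-set, $A^{ -1}(N)$ is a down-set, and $A^{ -1}(N)^c\subseteq A^{ -1}(P)$ (resp. $A^{ -1}(P)^c\subseteq A^{ -1}(N)$). For a family $\mathcal{H}$ of total maps $X\to\mathbf{2}$ and $A\in\mathcal{H}$, $W\subseteq X$ is an $\mathcal{H}$-core for $A$ if every $A'\in\mathcal{H}$ with $A'|_W=A|_W$ satisfies $A'=A$. -}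

module Defs where

open import Level using (Level; _⊔_; suc)
open import Data.Nat using (ℕ)
open import Data.Fin using (Fin)
open import Data.Product using (Σ; ∃; _×_; _,_)
open import Data.Sum using (_⊎_)
open import Relation.Binary.PropositionalEquality using (_≡_; _≢_)
open import Relation.Binary.Structures using (IsPartialOrder)
open import Function.Bundles using (_↔_)

data Two : Set where
  N P : Two

record FinStrongInvPoset (a ℓ : Level) : Set (Level.suc (a ⊔ ℓ)) where
  field
    Carrier        : Set a
    _≤_            : Carrier → Carrier → Set ℓ
    isPartialOrder : IsPartialOrder _≡_ _≤_
    c              : Carrier → Carrier
    involutive     : ∀ x → c (c x) ≡ x
    antitone       : ∀ {x y} → x ≤ y → c y ≤ c x
    noFixedPoint   : (Σ Carrier λ u → Σ Carrier λ v → u ≢ v) → ∀ x → c x ≢ x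
    size           : ℕ
    finite         : Carrier ↔ Fin size

module _ {a ℓ : Level} (X : FinStrongInvPoset a ℓ) where
  open FinStrongInvPoset X

  IsUpSet : (Carrier → Set) → Set (a ⊔ ℓ)
  IsUpSet U = ∀ {x y} → x ≤ y → U x → U y

  IsDownSet : (Carrier → Set) → Set (a ⊔ ℓ)
  IsDownSet D = ∀ {x y} → x ≤ y → D y → D x

  preim : (Carrier → Two) → Two → Carrier → Set
  preim A v x = A x ≡ v

  W+ : (Carrier → Two) → Set (a ⊔ ℓ)
  W+ A = IsUpSet (preim A P) × IsDownSet (preim A N)
         × (∀ x → A x ≡ N → A (c x) ≡ P)

  W- : (Carrier → Two) → Set (a ⊔ ℓ)
  W- A = IsUpSet (preim A P) × IsDownSet (preim A N)
         × (∀ x → A x ≡ P → A (c x) ≡ N)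

  Min : (Carrier → Set) → Carrier → Set (a ⊔ ℓ)
  Min Z x = Z x × (∀ y → Z y → y ≤ x → y ≡ x)

  Max : (Carrier → Set) → Carrier → Set (a ⊔ ℓ)
  Max Z x = Z x × (∀ y → Z y → x ≤ y → y ≡ x)

  NA : (Carrier → Two) → Carrier → Set (a ⊔ ℓ)
  NA A x = Min (preim A P) x ⊎ Max (preim A N) x

  IsCore : ∀ {h w} → ((Carrier → Two) → Set h) → (Carrier → Two)
           → (Carrier → Set w) → Set (a ⊔ h ⊔ w)
  IsCore H A W = ∀ A' → H A' → (∀ x → W x → A' x ≡ A x) → ∀ x → A' x ≡ A x

-- A point x with A x = P but A' x = N lies above a minimal element of A⁻¹(P), since finite
-- posets are well-founded; as A'⁻¹(N) is a down-set, that minimal element is also sent to N by A',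
-- contradicting agreement on N(A). The case A x = N, A' x = P is the same argument in the dual
-- poset, where Max becomes Min.
module Submission where

open import Defs
open import Level using (Level)
import Data.Fin.Properties as Fin
open import Data.Fin.Induction using (po-wellFounded)
open import Data.Product using (_×_; _,_)
open import Data.Sum using (inj₁; inj₂)
open import Data.Empty using (⊥-elim)
open import Function.Base using (flip)
open import Function.Bundles using (Inverse)
open import Function.Properties.Inverse using (↔⇒↣)
open import Induction.WellFounded using (WellFounded; Acc; acc; module Subrelation)
open import Relation.Nullary using (¬_; yes; no)
open import Relation.Nullary.Decidable using (via-injection)
open import Relation.Binary.Definitions using (DecidableEquality)
open import Relation.Binary.PropositionalEquality using (_≡_; refl; sym; trans; subst₂; _≗_)
import Relation.Binary.Construct.On as On
import Relation.Binary.Construct.Flip.EqAndOrd as Flip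
import Relation.Binary.Construct.NonStrictToStrict as ToStrict

dual : ∀ {a ℓ} → FinStrongInvPoset a ℓ → FinStrongInvPoset a ℓ
dual X = record
  { Carrier        = Carrier
  ; _≤_            = flip _≤_
  ; isPartialOrder = Flip.isPartialOrder isPartialOrder
  ; c              = c
  ; involutive     = involutive
  ; antitone       = antitone
  ; noFixedPoint   = noFixedPoint
  ; size           = size
  ; finite         = finite
  }
  where open FinStrongInvPoset X

module _ {a ℓ : Level} (X : FinStrongInvPoset a ℓ) where
  open FinStrongInvPoset X
  open Inverse finite using (to; from; strictlyInverseʳ)

  _<_ : Carrier → Carrier → Set (a Level.⊔ ℓ)
  _<_ = ToStrict._<_ _≡_ _≤_

  _≟_ : DecidableEquality Carrier
  _≟_ = via-injection (↔⇒↣ finite) Fin._≟_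

  -- Pull the order back to Fin size along `from`, where every partial order is well-founded.
  <-wellFounded : WellFounded _<_
  <-wellFounded = Subrelation.wellFounded through-Fin
    (On.wellFounded to (po-wellFounded (On.isPartialOrder from isPartialOrder)))
    where
    through-Fin : ∀ {x y} → x < y → from (to x) < from (to y)
    through-Fin {x} {y} = subst₂ _<_ (sym (strictlyInverseʳ x)) (sym (strictlyInverseʳ y))

  minimals-outside-downSet⇒disjoint : (U D : Carrier → Set) → IsDownSet X D
    → (∀ x → Min X U x → ¬ D x) → ∀ x → U x → ¬ D x
  minimals-outside-downSet⇒disjoint U D downD minimals-outside x = go x (<-wellFounded x)
    where
    go : ∀ x → Acc _<_ x → U x → ¬ D x
    go x (acc below) Ux Dx = minimals-outside x (Ux , minimal) Dx
      where
      minimal : ∀ y → U y → y ≤ x → y ≡ x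
      minimal y Uy y≤x with y ≟ x
      ... | yes y≡x = y≡x
      ... | no  y≢x = ⊥-elim (go y (below (y≤x , y≢x)) Uy (downD y≤x Dx))

N≢P : ¬ N ≡ P
N≢P ()

agree-on-NA⇒≗ : ∀ {a ℓ} (X : FinStrongInvPoset a ℓ) A A'
  → IsUpSet X (preim X A' P) → IsDownSet X (preim X A' N)
  → (∀ x → NA X A x → A' x ≡ A x) → A' ≗ A
agree-on-NA⇒≗ X A A' upA' downA' agree x with A x in Ax | A' x in A'x
... | N | N = refl
... | P | P = refl
... | P | N = ⊥-elim (minimals-outside-downSet⇒disjoint X (preim X A P) (preim X A' N) downA'
  (λ y min@(Ay , _) A'y → N≢P (trans (sym A'y) (trans (agree y (inj₁ min)) Ay))) x Ax A'x)
... | N | P = ⊥-elim (minimals-outside-downSet⇒disjoint (dual X) (preim X A N) (preim X A' P) upA'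
  (λ y max@(Ay , _) A'y → N≢P (trans (sym Ay) (trans (sym (agree y (inj₂ max))) A'y))) x Ax A'x)

proposition3p10 : ∀ {a ℓ : Level} (X : FinStrongInvPoset a ℓ)
    → (∀ A → W+ X A → IsCore X (W+ X) A (NA X A))
      × (∀ A → W- X A → IsCore X (W- X) A (NA X A))
proposition3p10 X =
    (λ A _ A' (upA' , downA' , _) → agree-on-NA⇒≗ X A A' upA' downA')
  , (λ A _ A' (upA' , downA' , _) → agree-on-NA⇒≗ X A A' upA' downA')
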